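{- Let $\mathcal N$ be one of the algebras $\langle\mathbb N;\mathrm{Suc}\rangle$, $\langle\mathbb N;+\rangle$, $\langle\mathbb N;+,\times\rangle$. For any $f\colon\mathbb N\to\mathbb N$ the following are equivalent: (i) $f$ is $\mathcal N$-congruence preserving; (ii) (a) $|y-x|$ divides $|f(y)-f(x)|$ for all $x,y\in\mathbb N$, and (b) either $f$ is constant or $f(x)\ge x$ for all $x\in\mathbb N$.
   Context: An $\mathcal N$-congruence is an equivalence relation $\sim$ on $\mathbb N$ compatible with each operation of $\mathcal N$ (arguments pairwise equivalent imply values equivalent). $f$ is $\mathcal N$-congruence preserving if $x\sim y$ implies $f(x)\sim f(y)$ for every $\mathcal N$-congruence $\sim$. -}

module Defs where

open import Data.Nat using (ℕ; suc; _+_; _*_)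
open import Relation.Binary.Core using (Rel)
open import Relation.Binary.Structures using (IsEquivalence)
open import Data.Product using (_×_)

data Algebra : Set where
  SucAlg  : Algebra
  AddAlg  : Algebra
  AddMulAlg : Algebra

Compatible₁ : Rel ℕ _ → (ℕ → ℕ) → Set
Compatible₁ _~_ g = ∀ {x y} → x ~ y → g x ~ g y

Compatible₂ : Rel ℕ _ → (ℕ → ℕ → ℕ) → Set
Compatible₂ _~_ op = ∀ {x x′ y y′} → x ~ x′ → y ~ y′ → op x y ~ op x′ y′

CompatibleWith : Algebra → Rel ℕ _ → Set
CompatibleWith SucAlg    _~_ = Compatible₁ _~_ suc
CompatibleWith AddAlg    _~_ = Compatible₂ _~_ _+_
CompatibleWith AddMulAlg _~_ = Compatible₂ _~_ _+_ × Compatible₂ _~_ _*_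

record IsCongruence (𝒩 : Algebra) (_~_ : Rel ℕ _) : Set where
  field
    isEquivalence : IsEquivalence _~_
    compatible    : CompatibleWith 𝒩 _~_

CongruencePreserving : Algebra → (ℕ → ℕ) → Set₁
CongruencePreserving 𝒩 f =
  ∀ (_~_ : Rel ℕ _) → IsCongruence 𝒩 _~_ → ∀ x y → x ~ y → f x ~ f y

-- The relations x % d ≡ y % d and x ⊓ c ≡ y ⊓ c (the latter collapses everything ≥ c)
-- are compatible with + and ×, hence are 𝒩-congruences for each 𝒩.  Preserving the
-- first gives (a); preserving the second shows that f c < c forces f to be constant
-- from c on, and then (a) makes it constant everywhere.  Conversely, every
-- 𝒩-congruence is compatible with suc, hence with translations, so x ~ x + p
-- propagates to m ~ m + q * p for all m ≥ x.  When x ≤ y and x ~ y, (a) and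
-- f z ≥ z make f x and f y two numbers ≥ x at distance a multiple of y ∸ x.
module Submission where

open import Defs
open import Data.Nat using (ℕ; zero; suc; _+_; _*_; _∸_; _⊓_; _≤_; _<_; _<?_; _≤?_; ∣_-_∣; NonZero; s≤s)
open import Data.Nat.Properties
open import Data.Nat.DivMod using (_%_; _/_; m≡m%n+[m/n]*n; %-distribˡ-+; %-distribˡ-*; %-remove-+ʳ; m<n⇒m%n≡m)
open import Data.Nat.Divisibility using (_∣_; divides; _∣0; ∣-refl; n∣m⇒m%n≡0)
open import Data.Product using (_×_; _,_; proj₁)
open import Data.Sum using (_⊎_; inj₁; inj₂)
open import Function.Base using (_on_)
open import Function.Bundles using (_⇔_; mk⇔)
open import Level using (0ℓ)
open import Relation.Nullary using (yes; no; contradiction)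
open import Relation.Binary.Core using (Rel)
open import Relation.Binary.Structures using (IsEquivalence)
open import Relation.Binary.PropositionalEquality
  using (_≡_; refl; sym; trans; cong; cong₂; subst; subst₂; module ≡-Reasoning)
import Relation.Binary.PropositionalEquality as ≡
import Relation.Binary.Construct.On as On

DifferencesDivide : (ℕ → ℕ) → Set
DifferencesDivide f = ∀ x y → ∣ y - x ∣ ∣ ∣ f y - f x ∣

Constant : (ℕ → ℕ) → Set
Constant f = ∀ x y → f x ≡ f y

Inflationary : (ℕ → ℕ) → Set
Inflationary f = ∀ x → x ≤ f x

Descends : (ℕ → ℕ) → (ℕ → ℕ → ℕ) → Set
Descends h _∙_ = ∀ x y → h (x ∙ y) ≡ h (h x ∙ h y)

kernel-compatible : ∀ h _∙_ → Descends h _∙_ → Compatible₂ (_≡_ on h) _∙_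
kernel-compatible h _∙_ descends {x} {x′} {y} {y′} hx≡hx′ hy≡hy′ = begin
  h (x ∙ y)       ≡⟨ descends x y ⟩
  h (h x ∙ h y)   ≡⟨ cong₂ (λ a b → h (a ∙ b)) hx≡hx′ hy≡hy′ ⟩
  h (h x′ ∙ h y′) ≡⟨ descends x′ y′ ⟨
  h (x′ ∙ y′)     ∎
  where open ≡-Reasoning

kernel-isCongruence : ∀ 𝒩 h → Descends h _+_ → Descends h _*_ → IsCongruence 𝒩 (_≡_ on h)
kernel-isCongruence 𝒩 h +-descends *-descends = record
  { isEquivalence = On.isEquivalence h ≡.isEquivalence
  ; compatible    = compatible 𝒩
  }
  where
  +-compatible : Compatible₂ (_≡_ on h) _+_
  +-compatible = kernel-compatible h _+_ +-descends
  compatible : ∀ 𝒩 → CompatibleWith 𝒩 (_≡_ on h)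
  compatible SucAlg    = +-compatible {1} {1} refl
  compatible AddAlg    = +-compatible
  compatible AddMulAlg = +-compatible , kernel-compatible h _*_ *-descends

%-descends-+ : ∀ d .{{_ : NonZero d}} → Descends (_% d) _+_
%-descends-+ d m n = %-distribˡ-+ m n d

%-descends-* : ∀ d .{{_ : NonZero d}} → Descends (_% d) _*_
%-descends-* d m n = %-distribˡ-* m n d

m%d≡n%d⇒d∣∣m-n∣ : ∀ {d} .{{_ : NonZero d}} m n → m % d ≡ n % d → d ∣ ∣ m - n ∣
m%d≡n%d⇒d∣∣m-n∣ {d} m n m%d≡n%d = divides ∣ m / d - n / d ∣ (begin
  ∣ m - n ∣                                     ≡⟨ cong₂ ∣_-_∣ (m≡m%n+[m/n]*n m d) (m≡m%n+[m/n]*n n d) ⟩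
  ∣ m % d + m / d * d - n % d + n / d * d ∣     ≡⟨ cong (λ r → ∣ m % d + m / d * d - r + n / d * d ∣) m%d≡n%d ⟨
  ∣ m % d + m / d * d - m % d + n / d * d ∣     ≡⟨ ∣m+n-m+o∣≡∣n-o∣ (m % d) _ _ ⟩
  ∣ m / d * d - n / d * d ∣                     ≡⟨ *-distribʳ-∣-∣ d (m / d) (n / d) ⟨
  ∣ m / d - n / d ∣ * d                         ∎)
  where open ≡-Reasoning

n%d≡m%d⇐d∣n∸m : ∀ {d} .{{_ : NonZero d}} {m n} → m ≤ n → d ∣ n ∸ m → n % d ≡ m % d
n%d≡m%d⇐d∣n∸m {d} {m} {n} m≤n d∣n∸m = begin
  n % d             ≡⟨ cong (_% d) (m+[n∸m]≡n m≤n) ⟨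
  (m + (n ∸ m)) % d ≡⟨ %-remove-+ʳ m d∣n∸m ⟩
  m % d             ∎
  where open ≡-Reasoning

d∣∣m-n∣⇒m%d≡n%d : ∀ {d} .{{_ : NonZero d}} m n → d ∣ ∣ m - n ∣ → m % d ≡ n % d
d∣∣m-n∣⇒m%d≡n%d {d} m n d∣∣m-n∣ with ≤-total m n
... | inj₁ m≤n = sym (n%d≡m%d⇐d∣n∸m m≤n (subst (d ∣_) (m≤n⇒∣m-n∣≡n∸m m≤n) d∣∣m-n∣))
... | inj₂ n≤m = n%d≡m%d⇐d∣n∸m n≤m (subst (d ∣_) (m≤n⇒∣n-m∣≡n∸m n≤m) d∣∣m-n∣)

⊓-saturated : ∀ {c a b} → c ≤ a → c ≤ b → a ⊓ c ≡ b ⊓ c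
⊓-saturated c≤a c≤b = trans (m≥n⇒m⊓n≡n c≤a) (sym (m≥n⇒m⊓n≡n c≤b))

⊓-descends-+ : ∀ c → Descends (_⊓ c) _+_
⊓-descends-+ c x y with ≤-total c x | ≤-total c y
... | inj₁ c≤x | _ = trans
  (⊓-saturated (≤-trans c≤x (m≤m+n x y)) (m≤m+n c (y ⊓ c)))
  (cong (λ a → (a + y ⊓ c) ⊓ c) (sym (m≥n⇒m⊓n≡n c≤x)))
... | _ | inj₁ c≤y = trans
  (⊓-saturated (≤-trans c≤y (m≤n+m y x)) (m≤n+m c (x ⊓ c)))
  (cong (λ b → (x ⊓ c + b) ⊓ c) (sym (m≥n⇒m⊓n≡n c≤y)))
... | inj₂ x≤c | inj₂ y≤c =
  cong₂ (λ a b → (a + b) ⊓ c) (sym (m≤n⇒m⊓n≡m x≤c)) (sym (m≤n⇒m⊓n≡m y≤c))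

⊓-descends-* : ∀ c → Descends (_⊓ c) _*_
⊓-descends-* c       zero      y    = refl
⊓-descends-* c       x@(suc _) zero = cong (_⊓ c) (trans (*-zeroʳ x) (sym (*-zeroʳ (x ⊓ c))))
⊓-descends-* zero    x@(suc _) y    = trans (⊓-zeroʳ (x * y)) (sym (⊓-zeroʳ (x ⊓ 0 * y ⊓ 0)))
⊓-descends-* c@(suc _) x@(suc _) y@(suc _) with ≤-total c x | ≤-total c y
... | inj₁ c≤x | _ = trans
  (⊓-saturated (≤-trans c≤x (m≤m*n x y)) (m≤m*n c (y ⊓ c)))
  (cong (λ a → (a * (y ⊓ c)) ⊓ c) (sym (m≥n⇒m⊓n≡n c≤x)))
... | _ | inj₁ c≤y = trans
  (⊓-saturated (≤-trans c≤y (m≤n*m y x)) (m≤n*m c (x ⊓ c)))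
  (cong (λ b → (x ⊓ c * b) ⊓ c) (sym (m≥n⇒m⊓n≡n c≤y)))
... | inj₂ x≤c | inj₂ y≤c =
  cong₂ (λ a b → (a * b) ⊓ c) (sym (m≤n⇒m⊓n≡m x≤c)) (sym (m≤n⇒m⊓n≡m y≤c))

⊓-below : ∀ {a b c} → a ⊓ c ≡ b → b < c → a ≡ b
⊓-below {a} {b} {c} a⊓c≡b b<c with ≤-total a c
... | inj₁ a≤c = trans (sym (m≤n⇒m⊓n≡m a≤c)) a⊓c≡b
... | inj₂ c≤a = contradiction (trans (sym (m≥n⇒m⊓n≡n c≤a)) a⊓c≡b) (>⇒≢ b<c)

module _ {𝒩 f} (preserving : CongruencePreserving 𝒩 f) where

  preserves-kernel : ∀ h → Descends h _+_ → Descends h _*_ →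
                     ∀ {x y} → h x ≡ h y → h (f x) ≡ h (f y)
  preserves-kernel h +-descends *-descends {x} {y} =
    preserving (_≡_ on h) (kernel-isCongruence 𝒩 h +-descends *-descends) x y

  preserving⇒differencesDivide : DifferencesDivide f
  preserving⇒differencesDivide x y with ∣ y - x ∣ in ∣y-x∣≡d
  ... | zero = subst (0 ∣_) (sym ∣fy-fx∣≡0) (0 ∣0)
    where
    ∣fy-fx∣≡0 : ∣ f y - f x ∣ ≡ 0
    ∣fy-fx∣≡0 = m≡n⇒∣m-n∣≡0 (cong f (∣m-n∣≡0⇒m≡n ∣y-x∣≡d))
  ... | d@(suc _) = m%d≡n%d⇒d∣∣m-n∣ (f y) (f x)
    (preserves-kernel (_% d) (%-descends-+ d) (%-descends-* d)
      (d∣∣m-n∣⇒m%d≡n%d y x (subst (d ∣_) (sym ∣y-x∣≡d) ∣-refl)))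

  below-diagonal⇒eventually-constant : ∀ {c} → f c < c → ∀ y → c ≤ y → f y ≡ f c
  below-diagonal⇒eventually-constant {c} fc<c y c≤y = ⊓-below fy⊓c≡fc fc<c
    where
    fy⊓c≡fc : f y ⊓ c ≡ f c
    fy⊓c≡fc = trans
      (preserves-kernel (_⊓ c) (⊓-descends-+ c) (⊓-descends-* c) (⊓-saturated c≤y ≤-refl))
      (m≤n⇒m⊓n≡m (<⇒≤ fc<c))

eventually-constant⇒constant : ∀ {f} → DifferencesDivide f →
                               ∀ c → (∀ y → c ≤ y → f y ≡ f c) → Constant f
eventually-constant⇒constant {f} divide c eventually x y = trans (≡fc x) (sym (≡fc y))
  where
  ≡fc : ∀ z → f z ≡ f c
  ≡fc z = ∣m-n∣≡0⇒m≡n d≡0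
    where
    d k : ℕ
    d = ∣ f z - f c ∣
    -- k exceeds both c and d: z + k lies in the constant range, and k ∣ d forces d = 0.
    k = suc (d + c)
    k∣d : k ∣ d
    k∣d = subst₂ _∣_ (∣m-m+n∣≡n z k)
      (cong (∣ f z -_∣) (eventually (z + k) (≤-trans (m≤n+m c (suc d)) (m≤n+m k z))))
      (divide (z + k) z)
    d≡0 : d ≡ 0
    d≡0 = trans (sym (m<n⇒m%n≡m (s≤s (m≤m+n d c)))) (n∣m⇒m%n≡0 d k k∣d)

-- It suffices to test the single point suc (f 0): if f is not below the diagonal there,
-- then f (suc (f 0)) ≢ f 0, so f is nowhere below the diagonal.
constant-or-inflationary : ∀ {f} → (∀ c → f c < c → Constant f) → Constant f ⊎ Inflationary f
constant-or-inflationary {f} below⇒constant with f (suc (f 0)) <? suc (f 0)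
... | yes below = inj₁ (below⇒constant _ below)
... | no ¬below = inj₂ inflationary
  where
  inflationary : Inflationary f
  inflationary x with x ≤? f x
  ... | yes x≤fx = x≤fx
  ... | no  x≰fx = contradiction (below⇒constant x (≰⇒> x≰fx) (suc (f 0)) 0) (>⇒≢ (≮⇒≥ ¬below))

IsCongruence⇒suc-compatible : ∀ {𝒩 _~_} → IsCongruence 𝒩 _~_ → Compatible₁ _~_ suc
IsCongruence⇒suc-compatible {SucAlg}    C = IsCongruence.compatible C
IsCongruence⇒suc-compatible {AddAlg}    C =
  IsCongruence.compatible C {1} {1} (IsEquivalence.refl (IsCongruence.isEquivalence C))
IsCongruence⇒suc-compatible {AddMulAlg} C =
  proj₁ (IsCongruence.compatible C) {1} {1} (IsEquivalence.refl (IsCongruence.isEquivalence C))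

module _ {𝒩} {R : Rel ℕ 0ℓ} (congruence : IsCongruence 𝒩 R) where
  infix 4 _~_
  _~_ : Rel ℕ 0ℓ
  _~_ = R

  open IsCongruence congruence using (isEquivalence)
  open IsEquivalence isEquivalence using () renaming (refl to ~-refl; sym to ~-sym; trans to ~-trans)

  +-compatibleˡ : ∀ j {u v} → u ~ v → j + u ~ j + v
  +-compatibleˡ zero    u~v = u~v
  +-compatibleˡ (suc j) u~v = IsCongruence⇒suc-compatible congruence (+-compatibleˡ j u~v)

  shift-above : ∀ {x p m} → x ~ x + p → x ≤ m → m ~ m + p
  shift-above {x} {p} {m} x~x+p x≤m =
    subst₂ _~_ (m∸n+n≡m x≤m) m∸x+[x+p]≡m+p (+-compatibleˡ (m ∸ x) x~x+p)
    where
    m∸x+[x+p]≡m+p : m ∸ x + (x + p) ≡ m + p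
    m∸x+[x+p]≡m+p = trans (sym (+-assoc (m ∸ x) x p)) (cong (_+ p) (m∸n+n≡m x≤m))

  multiple-shift-above : ∀ {x p m} → x ~ x + p → x ≤ m → ∀ q → m ~ m + q * p
  multiple-shift-above {m = m} x~x+p x≤m zero = subst (m ~_) (sym (+-identityʳ m)) ~-refl
  multiple-shift-above {p = p} {m} x~x+p x≤m (suc q) = ~-trans
    (multiple-shift-above x~x+p x≤m q)
    (subst (m + q * p ~_) reassociate (shift-above x~x+p (≤-trans x≤m (m≤m+n m (q * p)))))
    where
    reassociate : m + q * p + p ≡ m + suc q * p
    reassociate = trans (+-assoc m (q * p) p) (cong (m +_) (+-comm (q * p) p))

  ∣∸⇒~ : ∀ {x p a b} → x ~ x + p → x ≤ a → a ≤ b → p ∣ b ∸ a → a ~ b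
  ∣∸⇒~ {p = p} {a} {b} x~x+p x≤a a≤b (divides q b∸a≡q*p) =
    subst (a ~_) a+q*p≡b (multiple-shift-above x~x+p x≤a q)
    where
    a+q*p≡b : a + q * p ≡ b
    a+q*p≡b = trans (cong (a +_) (sym b∸a≡q*p)) (m+[n∸m]≡n a≤b)

  ∣∣-∣⇒~ : ∀ {x p a b} → x ~ x + p → x ≤ a → x ≤ b → p ∣ ∣ a - b ∣ → a ~ b
  ∣∣-∣⇒~ {p = p} {a} {b} x~x+p x≤a x≤b p∣∣a-b∣ with ≤-total a b
  ... | inj₁ a≤b = ∣∸⇒~ x~x+p x≤a a≤b (subst (p ∣_) (m≤n⇒∣m-n∣≡n∸m a≤b) p∣∣a-b∣)
  ... | inj₂ b≤a = ~-sym (∣∸⇒~ x~x+p x≤b b≤a (subst (p ∣_) (m≤n⇒∣n-m∣≡n∸m b≤a) p∣∣a-b∣))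

  module _ {f} (divide : DifferencesDivide f) (inflationary : Inflationary f) where

    preserves-≤ : ∀ {x y} → x ≤ y → x ~ y → f x ~ f y
    preserves-≤ {x} {y} x≤y x~y =
      ∣∣-∣⇒~ x~x+[y∸x] (inflationary x) (≤-trans x≤y (inflationary y)) y∸x∣∣fx-fy∣
      where
      x~x+[y∸x] : x ~ x + (y ∸ x)
      x~x+[y∸x] = subst (x ~_) (sym (m+[n∸m]≡n x≤y)) x~y
      y∸x∣∣fx-fy∣ : y ∸ x ∣ ∣ f x - f y ∣
      y∸x∣∣fx-fy∣ = subst₂ _∣_ (m≤n⇒∣n-m∣≡n∸m x≤y) (∣-∣-comm (f y) (f x)) (divide x y)

    preserves : ∀ x y → x ~ y → f x ~ f y
    preserves x y x~y with ≤-total x y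
    ... | inj₁ x≤y = preserves-≤ x≤y x~y
    ... | inj₂ y≤x = ~-sym (preserves-≤ y≤x (~-sym x~y))

constant⇒preserving : ∀ {𝒩 f} → Constant f → CongruencePreserving 𝒩 f
constant⇒preserving {f = f} constant _~_ congruence x y _ =
  subst (f x ~_) (constant x y) (IsEquivalence.refl (IsCongruence.isEquivalence congruence))

differencesDivide∧inflationary⇒preserving : ∀ {𝒩 f} → DifferencesDivide f → Inflationary f →
                                            CongruencePreserving 𝒩 f
differencesDivide∧inflationary⇒preserving divide inflationary _~_ congruence =
  preserves congruence divide inflationary

theorem3p7 : (𝒩 : Algebra) (f : ℕ → ℕ) →
    CongruencePreserving 𝒩 f ⇔
      ((∀ x y → ∣ y - x ∣ ∣ ∣ f y - f x ∣)
       × ((∀ x y → f x ≡ f y) ⊎ (∀ x → x ≤ f x)))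
theorem3p7 𝒩 f = mk⇔ necessary sufficient
  where
  necessary : CongruencePreserving 𝒩 f → DifferencesDivide f × (Constant f ⊎ Inflationary f)
  necessary preserving =
      preserving⇒differencesDivide preserving
    , constant-or-inflationary λ c fc<c →
        eventually-constant⇒constant (preserving⇒differencesDivide preserving) c
          (below-diagonal⇒eventually-constant preserving fc<c)

  sufficient : DifferencesDivide f × (Constant f ⊎ Inflationary f) → CongruencePreserving 𝒩 f
  sufficient (_      , inj₁ constant)     = constant⇒preserving constant
  sufficient (divide , inj₂ inflationary) = differencesDivide∧inflationary⇒preserving divide inflationary
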